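{- Let $k,m,n_2,n$ be positive integers with $k+1=n_2$ and $n>n_2$. Let $w\in S_{n_2}$ (viewed in $S_n$) and $u\in S_n$ with $u\dashv h_m\mathfrak{S}_w(x_1,\dots,x_k)$. Then $u$ is of one of the following forms: (1) $u=wt_{a,k+2}t_{a,k+3}\cdots t_{a,k+m+1}$ for some $1\le a\le k$; (2) $u=wt_{a,k+1}t_{a,k+2}\cdots t_{a,k+m}$ for some $1\le a\le k$; (3) $u=wt_{a_1,k+1}t_{a_2,k+2}\cdots t_{a_2,k+m}$ for some $1\le a_1,a_2\le k$ with $a_1\ne a_2$ (not necessarily $a_1<a_2$).
   Context: $\mathfrak{S}_w$ is the Schubert polynomial of $w$, $h_m(x_1,\dots,x_k)$ the complete homogeneous symmetric polynomial of degree $m$ in $k$ variables, $t_{ab}$ the transposition of positions $a,b$ (so $wt_{ab}$ swaps the values in positions $a,b$), $\ell$ Coxeter length. By Sottile's Pieri rule, $\mathfrak{S}_w h_m(x_1,\dots,x_k)=\sum_v \mathfrak{S}_v$, summed over all $v=wt_{a_1b_1}\cdots t_{a_mb_m}$ with $a_i\le k<b_i$, $a_1\le\dots\le a_m$, $b_1,\dots,b_m$ distinct, and $\ell(wt_{a_1b_1}\cdots t_{a_ib_i})=\ell(w)+i$ for all $i$. We write $u\dashv h_m\mathfrak{S}_w(x_1,\dots,x_k)$ if $\mathfrak{S}_u$ is a term of this sum. -}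

module Defs where

open import Data.Nat using (ℕ; zero; suc; _+_; _∸_; _≤_; _<_; _<?_; _≡ᵇ_)
open import Data.Bool using (if_then_else_)
open import Data.List using (List; []; _∷_; map; length; filter; upTo; _++_)
open import Data.List.Relation.Binary.Permutation.Propositional using (_↭_)
open import Data.List.Relation.Unary.Unique.Propositional using (Unique)
open import Data.List.Relation.Unary.Linked using (Linked)
open import Data.Product using (Σ; _×_; _,_; proj₁; proj₂)
open import Data.Unit using (⊤)
open import Relation.Binary.PropositionalEquality using (_≡_)

-- Permutations are given in one-line notation as lists of naturals,
-- positions and values 1-indexed.

seg : ℕ → ℕ → List ℕ
seg lo len = map (lo +_) (upTo len)

IsPerm : ℕ → List ℕ → Set
IsPerm n w = w ↭ seg 1 n

embed : ℕ → ℕ → List ℕ → List ℕ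
embed n₂ n w = w ++ seg (suc n₂) (n ∸ n₂)

-- entry at (1-indexed) position i; 0 if out of range
at : List ℕ → ℕ → ℕ
at [] _ = 0
at (x ∷ xs) zero = 0
at (x ∷ xs) (suc zero) = x
at (x ∷ xs) (suc (suc i)) = at xs (suc i)

τ : ℕ → ℕ → ℕ → ℕ
τ a b i = if i ≡ᵇ a then b else (if i ≡ᵇ b then a else i)

-- w t_{ab} : swap the values in positions a and b
swapT : ℕ → ℕ → List ℕ → List ℕ
swapT a b w = map (λ i → at w (τ a b i)) (seg 1 (length w))

mulTs : List ℕ → List (ℕ × ℕ) → List ℕ
mulTs w [] = w
mulTs w ((a , b) ∷ ps) = mulTs (swapT a b w) ps

-- Coxeter length = number of inversions
len : List ℕ → ℕ
len [] = 0
len (x ∷ xs) = length (filter (_<? x) xs) + len xs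

PieriSteps : ℕ → List ℕ → List (ℕ × ℕ) → Set
PieriSteps k w [] = ⊤
PieriSteps k w ((a , b) ∷ ps) =
  1 ≤ a × a ≤ k × k < b × b ≤ length w ×
  len (swapT a b w) ≡ suc (len w) × PieriSteps k (swapT a b w) ps

-- u ⊣ h_m 𝔖_w(x_1,…,x_k)   (Sottile's Pieri rule), for w, u in S_n
PieriTerm : ℕ → ℕ → List ℕ → List ℕ → Set
PieriTerm k m w u =
  Σ (List (ℕ × ℕ)) λ ps →
    length ps ≡ m ×
    Linked _≤_ (map proj₁ ps) ×
    Unique (map proj₂ ps) ×
    PieriSteps k w ps ×
    u ≡ mulTs w ps

-- If the transposition t_{ab} (a < b) raises the number of inversions of p by exactly one, then
-- p(a) < p(b) and no position strictly between a and b carries a value in [p(a), p(b)]: this is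
-- read off from the change in inversions, which involves only p(a), p(b) and the entries between.
-- Now let w ∈ S_{k+1} ⊆ S_n.  The first b of a Pieri chain is k+1 or k+2, as the fixed point k+2
-- would otherwise lie between.  After a step t_{a,k+2} position a holds the largest value reached
-- so far, and position k+2 holds w(a), which exceeds the entries at positions a+1, …, k+1.  Hence
-- every later step t_{a′,b} with b ≥ k+2 has a′ = a and b = (previous b) + 1, while a step
-- t_{a′,k+1} must have a′ > a and is the last one; it commutes with the t_{a,b} before it.

module Submission where

open import Defs
open import Data.Nat
open import Data.Nat.Properties
open import Data.Nat.Tactic.RingSolver using (solve-∀)
open import Data.List
open import Data.List.Properties
  using (length-++; filter-++; length-map; length-upTo; map-upTo; map-∘; map-cong)
open import Data.List.Membership.Propositional.Properties using (∈-applyUpTo⁻)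
open import Data.List.Membership.Propositional using (_∈_)
open import Data.List.Relation.Unary.Any using (here; there)
open import Data.List.Relation.Unary.All as All using (All; []; _∷_)
open import Data.List.Relation.Unary.AllPairs using ([]; _∷_)
open import Data.List.Relation.Unary.Linked using (Linked; _∷_)
open import Data.List.Relation.Unary.Unique.Propositional using (Unique)
open import Data.List.Relation.Binary.Permutation.Propositional
  using (_↭_; prep; swap; ↭-refl; ↭-sym; ↭-trans)
open import Data.List.Relation.Binary.Permutation.Propositional.Properties
  using (↭-length; filter-↭; ++⁺ˡ; shift; ∈-resp-↭)
open import Data.Bool using (true; false)
open import Data.Empty using (⊥; ⊥-elim)
open import Data.Product using (Σ; _×_; _,_; proj₁; proj₂; uncurry)
open import Data.Sum using (_⊎_; inj₁; inj₂)
open import Relation.Nullary using (¬_; yes; no)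
open import Function using (_∘_; id)
open import Relation.Unary using (Pred; Decidable)
open import Relation.Binary.PropositionalEquality hiding ([_])

-- Counting inversions

module _ {a p q} {A : Set a} {P : Pred A p} {Q : Pred A q}
         (P? : Decidable P) (Q? : Decidable Q) (P⇒Q : ∀ {z} → P z → Q z) where

  length-filter-mono : ∀ xs → length (filter P? xs) ≤ length (filter Q? xs)
  length-filter-mono [] = z≤n
  length-filter-mono (z ∷ xs) with P? z | Q? z
  ... | yes _ | yes _ = s≤s (length-filter-mono xs)
  ... | yes p | no ¬q = ⊥-elim (¬q (P⇒Q p))
  ... | no _  | yes _ = m≤n⇒m≤1+n (length-filter-mono xs)
  ... | no _  | no _  = length-filter-mono xs

  length-filter-mono-< : ∀ {xs z} → z ∈ xs → ¬ P z → Q z →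
    length (filter P? xs) < length (filter Q? xs)
  length-filter-mono-< {z′ ∷ xs} (here refl) ¬p q with P? z′ | Q? z′
  ... | yes p | _     = ⊥-elim (¬p p)
  ... | no _  | no ¬q = ⊥-elim (¬q q)
  ... | no _  | yes _ = s≤s (length-filter-mono xs)
  length-filter-mono-< {z′ ∷ xs} (there z∈xs) ¬p q with P? z′ | Q? z′
  ... | yes _ | yes _ = s≤s (length-filter-mono-< z∈xs ¬p q)
  ... | yes p | no ¬q = ⊥-elim (¬q (P⇒Q p))
  ... | no _  | yes _ = m<n⇒m<1+n (length-filter-mono-< z∈xs ¬p q)
  ... | no _  | no _  = length-filter-mono-< z∈xs ¬p q

length-filter-++ : ∀ {a p} {A : Set a} {P : Pred A p} (P? : Decidable P) xs ys →
  length (filter P? (xs ++ ys)) ≡ length (filter P? xs) + length (filter P? ys)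
length-filter-++ P? xs ys = trans (cong length (filter-++ P? xs ys)) (length-++ (filter P? xs))

-- so that len (x ∷ A) = below x A + len A holds definitionally
below : ℕ → List ℕ → ℕ
below x A = length (filter (_<? x) A)

above : ℕ → List ℕ → ℕ
above y A = length (filter (y <?_) A)

below-↭ : ∀ x {A B} → A ↭ B → below x A ≡ below x B
below-↭ x A↭B = ↭-length (filter-↭ (_<? x) A↭B)

below-singleton : ∀ x y → below x [ y ] ≡ above y [ x ]
below-singleton x y with y <ᵇ x
... | true = refl
... | false = refl

below-singleton-< : ∀ {x y} → x < y → below y [ x ] ≡ 1
below-singleton-< {x} {y} x<y with x <ᵇ y | <⇒<ᵇ x<y
... | true | _ = refl

below-singleton-≮ : ∀ {x y} → ¬ x < y → below y [ x ] ≡ 0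
below-singleton-≮ {x} {y} x≮y with x <ᵇ y | <ᵇ⇒< x y
... | false | _ = refl
... | true | x<y = ⊥-elim (x≮y (x<y _))

below-mono : ∀ {x y} A → x ≤ y → below x A ≤ below y A
below-mono A x≤y = length-filter-mono (_<? _) (_<? _) (λ z<x → <-≤-trans z<x x≤y) A

above-anti : ∀ {x y} A → x ≤ y → above y A ≤ above x A
above-anti A x≤y = length-filter-mono (_ <?_) (_ <?_) (≤-<-trans x≤y) A

below+above-< : ∀ {x y z A} → z ∈ A → x ≤ z → z ≤ y → x < y →
  below x A + above y A < below y A + above x A
below+above-< {x} {y} {z} {A} z∈A x≤z z≤y x<y with z <? y
... | yes z<y = +-mono-<-≤
      (length-filter-mono-< (_<? x) (_<? y) (λ w<x → <-trans w<x x<y) z∈A (≤⇒≯ x≤z) z<y)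
      (above-anti A (<⇒≤ x<y))
... | no z≮y = +-mono-≤-<
      (below-mono A (<⇒≤ x<y))
      (length-filter-mono-< (y <?_) (x <?_) (<-trans x<y) z∈A (≤⇒≯ z≤y) (<-≤-trans x<y (≮⇒≥ z≮y)))

len-insert : ∀ A y B → len (A ++ y ∷ B) ≡ len (A ++ B) + (above y A + below y B)
len-insert [] y B = +-comm (below y B) (len B)
len-insert (z ∷ A) y B = begin
  below z (A ++ y ∷ B) + len (A ++ y ∷ B)
    ≡⟨ cong₂ _+_ below-z (len-insert A y B) ⟩
  (above y [ z ] + below z (A ++ B)) + (len (A ++ B) + (above y A + below y B))
    ≡⟨ shuffle (above y [ z ]) (below z (A ++ B)) (len (A ++ B)) (above y A) (below y B) ⟩
  len (z ∷ A ++ B) + ((above y [ z ] + above y A) + below y B)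
    ≡⟨ cong (λ i → len (z ∷ A ++ B) + (i + below y B)) (length-filter-++ (y <?_) [ z ] A) ⟨
  len (z ∷ A ++ B) + (above y (z ∷ A) + below y B) ∎
  where
  open ≡-Reasoning
  below-z : below z (A ++ y ∷ B) ≡ above y [ z ] + below z (A ++ B)
  below-z = begin
    below z (A ++ y ∷ B)              ≡⟨ below-↭ z (shift y A B) ⟩
    below z (y ∷ A ++ B)              ≡⟨ length-filter-++ (_<? z) [ y ] (A ++ B) ⟩
    below z [ y ] + below z (A ++ B)  ≡⟨ cong (_+ below z (A ++ B)) (below-singleton z y) ⟩
    above y [ z ] + below z (A ++ B)  ∎
  shuffle : ∀ i b l s t → (i + b) + (l + (s + t)) ≡ (b + l) + ((i + s) + t)
  shuffle = solve-∀

-- the inversions of x ∷ A ++ [ y ] in which x or y takes part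
endInversions : ℕ → List ℕ → ℕ → ℕ
endInversions x A y = below x A + above y A + below x [ y ]

len-cons-insert : ∀ x A y B → len (x ∷ A ++ y ∷ B) ≡
  (below x A + (below x [ y ] + below x B)) + (len (A ++ B) + (above y A + below y B))
len-cons-insert x A y B = cong₂ _+_
  (trans (length-filter-++ (_<? x) A (y ∷ B)) (cong (below x A +_) (length-filter-++ (_<? x) [ y ] B)))
  (len-insert A y B)

len-swap-ends : ∀ x A y B →
  len (x ∷ A ++ y ∷ B) + endInversions y A x ≡ len (y ∷ A ++ x ∷ B) + endInversions x A y
len-swap-ends x A y B rewrite len-cons-insert x A y B | len-cons-insert y A x B =
  shuffle (below x A) (below x [ y ]) (below x B) (len (A ++ B)) (above y A)
          (below y B) (below y A) (above x A) (below y [ x ])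
  where
  shuffle : ∀ bxA bxy bxB l ayA byB byA axA byx →
    (bxA + (bxy + bxB)) + (l + (ayA + byB)) + (byA + axA + byx) ≡
    (byA + (byx + byB)) + (l + (axA + bxB)) + (bxA + ayA + bxy)
  shuffle = solve-∀

swap-ends-↭ : ∀ (x : ℕ) A y B → x ∷ A ++ y ∷ B ↭ y ∷ A ++ x ∷ B
swap-ends-↭ x A y B =
  ↭-trans (prep x (shift y A B)) (↭-trans (swap x y ↭-refl) (prep y (↭-sym (shift x A B))))

len-swap : ∀ P x A y B →
  len (P ++ x ∷ A ++ y ∷ B) + endInversions y A x ≡ len (P ++ y ∷ A ++ x ∷ B) + endInversions x A y
len-swap [] x A y B = len-swap-ends x A y B
len-swap (z ∷ P) x A y B = begin
  below z p + len p + endInversions y A x    ≡⟨ +-assoc (below z p) _ _ ⟩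
  below z p + (len p + endInversions y A x)  ≡⟨ cong₂ _+_ (below-↭ z (++⁺ˡ P (swap-ends-↭ x A y B)))
                                                          (len-swap P x A y B) ⟩
  below z q + (len q + endInversions x A y)  ≡⟨ +-assoc (below z q) _ _ ⟨
  below z q + len q + endInversions x A y    ∎
  where
  open ≡-Reasoning
  p q : List ℕ
  p = P ++ x ∷ A ++ y ∷ B
  q = P ++ y ∷ A ++ x ∷ B

len-swap-suc⇒ : ∀ P x A y B → len (P ++ y ∷ A ++ x ∷ B) ≡ suc (len (P ++ x ∷ A ++ y ∷ B)) →
  x < y × (∀ {z} → z ∈ A → x ≤ z → z ≤ y → ⊥)
len-swap-suc⇒ P x A y B len-suc = x<y , no-middle
  where
  open ≡-Reasoning
  p : List ℕ
  p = P ++ x ∷ A ++ y ∷ B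
  weights : endInversions y A x ≡ suc (endInversions x A y)
  weights = +-cancelˡ-≡ (len p) _ _ (begin
    len p + endInversions y A x                  ≡⟨ len-swap P x A y B ⟩
    len (P ++ y ∷ A ++ x ∷ B) + endInversions x A y ≡⟨ cong (_+ endInversions x A y) len-suc ⟩
    suc (len p) + endInversions x A y            ≡⟨ +-suc (len p) _ ⟨
    len p + suc (endInversions x A y)            ∎)
  x<y : x < y
  x<y with x <? y
  ... | yes x<y = x<y
  ... | no x≮y = ⊥-elim (≤⇒≯
          (+-mono-≤ (+-mono-≤ (below-mono A y≤x) (above-anti A y≤x))
                    (≤-trans (≤-reflexive (below-singleton-≮ x≮y)) z≤n))
          (≤-reflexive (sym weights)))
    where
    y≤x : y ≤ x
    y≤x = ≮⇒≥ x≮y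
  balanced : below y A + above x A ≡ below x A + above y A
  balanced = suc-injective (begin
    suc (below y A + above x A)                  ≡⟨ +-comm 1 _ ⟩
    below y A + above x A + 1
      ≡⟨ cong (below y A + above x A +_) (below-singleton-< x<y) ⟨
    endInversions y A x                          ≡⟨ weights ⟩
    suc (below x A + above y A + below x [ y ])  ≡⟨ cong (λ i → suc (below x A + above y A + i))
                                                         (below-singleton-≮ (<⇒≯ x<y)) ⟩
    suc (below x A + above y A + 0)              ≡⟨ cong suc (+-identityʳ _) ⟩
    suc (below x A + above y A)                  ∎)
  no-middle : ∀ {z} → z ∈ A → x ≤ z → z ≤ y → ⊥
  no-middle z∈A x≤z z≤y = <-irrefl (sym balanced) (below+above-< z∈A x≤z z≤y x<y)

-- Positions and transpositions

-- the positions c at which at p c is an entry of p rather than the junk value 0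
record Position (p : List ℕ) (c : ℕ) : Set where
  constructor position
  field
    1≤c : 1 ≤ c
    c≤length : c ≤ length p

position-within : ∀ {p n c} → length p ≡ n → 1 ≤ c → c ≤ n → Position p c
position-within length≡ 1≤c c≤n = position 1≤c (subst (_ ≤_) (sym length≡) c≤n)

at-zero : ∀ p → at p 0 ≡ 0
at-zero [] = refl
at-zero (_ ∷ _) = refl

at-ext : ∀ p q → length p ≡ length q → (∀ {c} → Position p c → at p c ≡ at q c) → p ≡ q
at-ext [] [] _ _ = refl
at-ext (x ∷ p) (y ∷ q) len≡ at≡ = cong₂ _∷_ (at≡ (position (s≤s z≤n) (s≤s z≤n)))
  (at-ext p q (suc-injective len≡) λ { {suc c} (position _ c≤) → at≡ (position (s≤s z≤n) (s≤s c≤)) })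

at-∈ : ∀ xs {i} → i < length xs → at xs (suc i) ∈ xs
at-∈ (x ∷ xs) {zero} _ = here refl
at-∈ (x ∷ xs) {suc i} (s≤s i<) = there (at-∈ xs i<)

at-++ˡ : ∀ P {R i} → i < length P → at (P ++ R) (suc i) ≡ at P (suc i)
at-++ˡ (x ∷ P) {i = zero} _ = refl
at-++ˡ (x ∷ P) {i = suc i} (s≤s i<) = at-++ˡ P i<

at-++ʳ : ∀ P R i → at (P ++ R) (suc (length P + i)) ≡ at R (suc i)
at-++ʳ [] R i = refl
at-++ʳ (z ∷ P) R i = at-++ʳ P R i

at-map : ∀ (g : ℕ → ℕ) xs {i} → i < length xs →
  at (map g xs) (suc i) ≡ g (at xs (suc i))
at-map g (x ∷ xs) {zero} _ = refl
at-map g (x ∷ xs) {suc i} (s≤s i<) = at-map g xs i<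

at-applyUpTo : ∀ (f : ℕ → ℕ) L {i} → i < L → at (applyUpTo f L) (suc i) ≡ f i
at-applyUpTo f (suc L) {zero} _ = refl
at-applyUpTo f (suc L) {suc i} (s≤s i<) = at-applyUpTo (f ∘ suc) L i<

seg≡applyUpTo : ∀ lo L → seg lo L ≡ applyUpTo (lo +_) L
seg≡applyUpTo lo = map-upTo (lo +_)

length-seg : ∀ lo L → length (seg lo L) ≡ L
length-seg lo L = trans (length-map (lo +_) (upTo L)) (length-upTo L)

at-seg : ∀ lo L {i} → i < L → at (seg lo L) (suc i) ≡ lo + i
at-seg lo L i< = trans (cong (λ xs → at xs _) (seg≡applyUpTo lo L)) (at-applyUpTo (lo +_) L i<)

∈-seg⇒< : ∀ lo L {v} → v ∈ seg lo L → v < lo + L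
∈-seg⇒< lo L v∈
  with _ , i<L , refl ← ∈-applyUpTo⁻ (lo +_) (subst (_ ∈_) (seg≡applyUpTo lo L) v∈) =
  +-monoʳ-< lo i<L

seg-suc : ∀ lo j → seg lo (suc j) ≡ lo ∷ seg (suc lo) j
seg-suc lo j = cong₂ _∷_ (+-identityʳ lo) (begin
  map (lo +_) (applyUpTo suc j)     ≡⟨ cong (map (lo +_)) (map-upTo suc j) ⟨
  map (lo +_) (map suc (upTo j))    ≡⟨ map-∘ (upTo j) ⟨
  map (λ i → lo + suc i) (upTo j)   ≡⟨ map-cong (+-suc lo) (upTo j) ⟩
  seg (suc lo) j                    ∎)
  where open ≡-Reasoning

τ-at-a : ∀ a b → τ a b a ≡ b
τ-at-a a b with a ≡ᵇ a | ≡⇒≡ᵇ a a refl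
... | true | _ = refl

τ-at-b : ∀ a b → τ a b b ≡ a
τ-at-b a b with b ≡ᵇ a | ≡ᵇ⇒≡ b a
... | true | b≡a = b≡a _
... | false | _ with b ≡ᵇ b | ≡⇒≡ᵇ b b refl
...   | true | _ = refl

τ-other : ∀ a b {c} → c ≢ a → c ≢ b → τ a b c ≡ c
τ-other a b {c} c≢a c≢b with c ≡ᵇ a | ≡ᵇ⇒≡ c a
... | true | c≡a = ⊥-elim (c≢a (c≡a _))
... | false | _ with c ≡ᵇ b | ≡ᵇ⇒≡ c b
...   | true | c≡b = ⊥-elim (c≢b (c≡b _))
...   | false | _ = refl

τ-preserves : ∀ {ℓ} (P : ℕ → Set ℓ) {a b c} → P a → P b → P c → P (τ a b c)
τ-preserves P {a} {b} {c} Pa Pb Pc with c ≟ a | c ≟ b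
... | yes refl | _ = subst P (sym (τ-at-a c b)) Pb
... | no _ | yes refl = subst P (sym (τ-at-b a c)) Pa
... | no c≢a | no c≢b = subst P (sym (τ-other a b c≢a c≢b)) Pc

τ-comm : ∀ {x y c d} z → x ≢ c → x ≢ d → y ≢ c → y ≢ d →
  τ c d (τ x y z) ≡ τ x y (τ c d z)
τ-comm {x} {y} {c} {d} z x≢c x≢d y≢c y≢d with z ≟ x | z ≟ y | z ≟ c | z ≟ d
... | yes refl | _ | _ | _
  rewrite τ-other c d x≢c x≢d | τ-at-a x y | τ-other c d y≢c y≢d = refl
... | no _ | yes refl | _ | _
  rewrite τ-other c d y≢c y≢d | τ-at-b x y | τ-other c d x≢c x≢d = refl
... | no z≢x | no z≢y | yes refl | _
  rewrite τ-other x y z≢x z≢y | τ-at-a c d | τ-other x y (≢-sym x≢d) (≢-sym y≢d) = refl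
... | no z≢x | no z≢y | no _ | yes refl
  rewrite τ-other x y z≢x z≢y | τ-at-b c d | τ-other x y (≢-sym x≢c) (≢-sym y≢c) = refl
... | no z≢x | no z≢y | no z≢c | no z≢d
  rewrite τ-other x y z≢x z≢y | τ-other c d z≢c z≢d | τ-other x y z≢x z≢y = refl

length-swapT : ∀ a b p → length (swapT a b p) ≡ length p
length-swapT a b p = trans (length-map _ (seg 1 (length p))) (length-seg 1 (length p))

position-swapT : ∀ a b {p c} → Position p c → Position (swapT a b p) c
position-swapT a b {p} (position 1≤c c≤) =
  position 1≤c (subst (_ ≤_) (sym (length-swapT a b p)) c≤)

position-swapT⁻ : ∀ a b {p c} → Position (swapT a b p) c → Position p c
position-swapT⁻ a b {p} (position 1≤c c≤) = position 1≤c (subst (_ ≤_) (length-swapT a b p) c≤)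

at-swapT : ∀ a b p {c} → Position p c → at (swapT a b p) c ≡ at p (τ a b c)
at-swapT a b p {suc i} (position _ c≤) = begin
  at (map (λ j → at p (τ a b j)) (seg 1 (length p))) (suc i)
    ≡⟨ at-map _ (seg 1 (length p)) (subst (i <_) (sym (length-seg 1 (length p))) c≤) ⟩
  at p (τ a b (at (seg 1 (length p)) (suc i)))
    ≡⟨ cong (λ j → at p (τ a b j)) (at-seg 1 (length p) c≤) ⟩
  at p (τ a b (suc i)) ∎
  where open ≡-Reasoning

at-swapT-a : ∀ {a} b p → Position p a → at (swapT a b p) a ≡ at p b
at-swapT-a {a} b p pos-a = trans (at-swapT a b p pos-a) (cong (at p) (τ-at-a a b))

at-swapT-b : ∀ a {b} p → Position p b → at (swapT a b p) b ≡ at p a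
at-swapT-b a {b} p pos-b = trans (at-swapT a b p pos-b) (cong (at p) (τ-at-b a b))

at-swapT-other : ∀ a b p {c} → Position p c → c ≢ a → c ≢ b → at (swapT a b p) c ≡ at p c
at-swapT-other a b p pos-c c≢a c≢b =
  trans (at-swapT a b p pos-c) (cong (at p) (τ-other a b c≢a c≢b))

at-middle : ∀ P (x : ℕ) R → at (P ++ x ∷ R) (suc (length P)) ≡ x
at-middle [] x R = refl
at-middle (z ∷ P) x R = at-middle P x R

at-update : ∀ P (x x′ : ℕ) R {j} → j ≢ suc (length P) →
  at (P ++ x ∷ R) j ≡ at (P ++ x′ ∷ R) j
at-update [] x x′ R {zero} _ = refl
at-update [] x x′ R {suc zero} j≢ = ⊥-elim (j≢ refl)
at-update [] x x′ R {suc (suc j)} _ = refl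
at-update (z ∷ P) x x′ R {zero} _ = refl
at-update (z ∷ P) x x′ R {suc zero} _ = refl
at-update (z ∷ P) x x′ R {suc (suc j)} j≢ = at-update P x x′ R (j≢ ∘ cong suc)

at-second : ∀ P (x : ℕ) A y B →
  at (P ++ x ∷ A ++ y ∷ B) (suc (suc (length P + length A))) ≡ y
at-second [] x A y B = at-middle A y B
at-second (z ∷ P) x A y B = at-second P x A y B

at-exchange-other : ∀ P (x : ℕ) A y B {j} →
  j ≢ suc (length P) → j ≢ suc (suc (length P + length A)) →
  at (P ++ x ∷ A ++ y ∷ B) j ≡ at (P ++ y ∷ A ++ x ∷ B) j
at-exchange-other [] x A y B {zero} _ _ = refl
at-exchange-other [] x A y B {suc zero} j≢a _ = ⊥-elim (j≢a refl)
at-exchange-other [] x A y B {suc (suc j)} _ j≢b = at-update A y x B (j≢b ∘ cong suc)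
at-exchange-other (z ∷ P) x A y B {zero} _ _ = refl
at-exchange-other (z ∷ P) x A y B {suc zero} _ _ = refl
at-exchange-other (z ∷ P) x A y B {suc (suc j)} j≢a j≢b =
  at-exchange-other P x A y B (j≢a ∘ cong suc) (j≢b ∘ cong suc)

at-between-∈ : ∀ P (x : ℕ) A y B {c} →
  suc (length P) < c → c < suc (suc (length P + length A)) → at (P ++ x ∷ A ++ y ∷ B) c ∈ A
at-between-∈ [] x A y B {suc zero} (s≤s ()) _
at-between-∈ [] x A y B {suc (suc i)} _ (s≤s (s≤s i<)) = subst (_∈ A) (sym (at-++ˡ A i<)) (at-∈ A i<)
at-between-∈ (z ∷ P) x A y B {suc (suc c)} (s≤s a<c) (s≤s c<b) = at-between-∈ P x A y B a<c c<b

swapT-exchange : ∀ P (x : ℕ) A y B →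
  swapT (suc (length P)) (suc (suc (length P + length A))) (P ++ x ∷ A ++ y ∷ B) ≡ P ++ y ∷ A ++ x ∷ B
swapT-exchange P x A y B =
  at-ext _ _ (trans (length-swapT a b p) (↭-length (++⁺ˡ P (swap-ends-↭ x A y B)))) pointwise
  where
  open ≡-Reasoning
  a b : ℕ
  a = suc (length P)
  b = suc (suc (length P + length A))
  p q : List ℕ
  p = P ++ x ∷ A ++ y ∷ B
  q = P ++ y ∷ A ++ x ∷ B
  pointwise : ∀ {j} → Position (swapT a b p) j → at (swapT a b p) j ≡ at q j
  pointwise {j} pos with j ≟ a | j ≟ b
  ... | yes refl | _ = begin
    at (swapT a b p) a  ≡⟨ at-swapT-a b p (position-swapT⁻ a b pos) ⟩
    at p b              ≡⟨ at-second P x A y B ⟩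
    y                   ≡⟨ at-middle P y (A ++ x ∷ B) ⟨
    at q a              ∎
  ... | no _ | yes refl = begin
    at (swapT a b p) b  ≡⟨ at-swapT-b a p (position-swapT⁻ a b pos) ⟩
    at p a              ≡⟨ at-middle P x (A ++ y ∷ B) ⟩
    x                   ≡⟨ at-second P y A x B ⟨
    at q b              ∎
  ... | no j≢a | no j≢b = begin
    at (swapT a b p) j  ≡⟨ at-swapT-other a b p (position-swapT⁻ a b pos) j≢a j≢b ⟩
    at p j              ≡⟨ at-exchange-other P x A y B j≢a j≢b ⟩
    at q j              ∎

split-at : ∀ p {i} → i < length p →
  Σ (List ℕ) λ P → Σ ℕ λ x → Σ (List ℕ) λ R → p ≡ P ++ x ∷ R × length P ≡ i
split-at (x ∷ p) {zero} _ = [] , x , p , refl , refl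
split-at (z ∷ p) {suc i} (s≤s i<) with split-at p i<
... | P , x , R , refl , refl = z ∷ P , x , R , refl , refl

decompose : ∀ p {a b} → 1 ≤ a → a < b → b ≤ length p →
  Σ (List ℕ) λ P → Σ ℕ λ x → Σ (List ℕ) λ A → Σ ℕ λ y → Σ (List ℕ) λ B →
    p ≡ P ++ x ∷ A ++ y ∷ B × a ≡ suc (length P) × b ≡ suc (suc (length P + length A))
decompose (x ∷ R) {suc zero} {suc zero} _ (s≤s ()) _
decompose (x ∷ R) {suc zero} {suc (suc o)} _ _ (s≤s o<) with split-at R o<
... | A , y , B , refl , refl = [] , x , A , y , B , refl , refl , refl
decompose (z ∷ p) {suc (suc a)} {suc b} _ (s≤s a<b) (s≤s b≤) with decompose p (s≤s z≤n) a<b b≤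
... | P , x , A , y , B , refl , refl , refl = z ∷ P , x , A , y , B , refl , refl , refl

-- For permutations, the criterion for the Bruhat covering p ⋖ p t_{ab}.
record BruhatCover (p : List ℕ) (a b : ℕ) : Set where
  field
    ascent : at p a < at p b
    no-value-between : ∀ {c} → a < c → c < b → at p a ≤ at p c → at p c ≤ at p b → ⊥

len-swapT-suc⇒cover : ∀ {p a b} → 1 ≤ a → a < b → b ≤ length p →
  len (swapT a b p) ≡ suc (len p) → BruhatCover p a b
len-swapT-suc⇒cover {p} 1≤a a<b b≤ len-suc with decompose p 1≤a a<b b≤
... | P , x , A , y , B , refl , refl , refl = record
  { ascent = subst₂ _<_ (sym at-a) (sym at-b) (proj₁ exchange)
  ; no-value-between = λ {c} a<c c<b x≤ ≤y → proj₂ exchange (at-between-∈ P x A y B a<c c<b)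
      (subst (_≤ at p c) at-a x≤) (subst (at p c ≤_) at-b ≤y)
  }
  where
  at-a : at p (suc (length P)) ≡ x
  at-a = at-middle P x (A ++ y ∷ B)
  at-b : at p (suc (suc (length P + length A))) ≡ y
  at-b = at-second P x A y B
  exchange : x < y × (∀ {z} → z ∈ A → x ≤ z → z ≤ y → ⊥)
  exchange = len-swap-suc⇒ P x A y B
    (subst (λ q → len q ≡ suc (len p)) (swapT-exchange P x A y B) len-suc)

-- Products of transpositions

swapT-comm : ∀ p {x y c d} → Position p x → Position p y → Position p c → Position p d →
  x ≢ c → x ≢ d → y ≢ c → y ≢ d → swapT x y (swapT c d p) ≡ swapT c d (swapT x y p)
swapT-comm p {x} {y} {c} {d} pos-x pos-y pos-c pos-d x≢c x≢d y≢c y≢d =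
  at-ext _ _ same-length pointwise
  where
  open ≡-Reasoning
  same-length : length (swapT x y (swapT c d p)) ≡ length (swapT c d (swapT x y p))
  same-length = trans (trans (length-swapT x y (swapT c d p)) (length-swapT c d p))
                      (sym (trans (length-swapT c d (swapT x y p)) (length-swapT x y p)))
  pointwise : ∀ {i} → Position (swapT x y (swapT c d p)) i →
    at (swapT x y (swapT c d p)) i ≡ at (swapT c d (swapT x y p)) i
  pointwise {i} pos = begin
    at (swapT x y (swapT c d p)) i  ≡⟨ at-swapT x y (swapT c d p) (position-swapT c d pos-i) ⟩
    at (swapT c d p) (τ x y i)      ≡⟨ at-swapT c d p (τ-preserves (Position p) pos-x pos-y pos-i) ⟩
    at p (τ c d (τ x y i))          ≡⟨ cong (at p) (τ-comm i x≢c x≢d y≢c y≢d) ⟩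
    at p (τ x y (τ c d i))          ≡⟨ at-swapT x y p (τ-preserves (Position p) pos-c pos-d pos-i) ⟨
    at (swapT x y p) (τ c d i)      ≡⟨ at-swapT c d (swapT x y p) (position-swapT x y pos-i) ⟨
    at (swapT c d (swapT x y p)) i  ∎
    where
    pos-i : Position p i
    pos-i = position-swapT⁻ c d (position-swapT⁻ x y pos)

mulTs-++ : ∀ p ps qs → mulTs p (ps ++ qs) ≡ mulTs (mulTs p ps) qs
mulTs-++ p [] qs = refl
mulTs-++ p ((a , b) ∷ ps) qs = mulTs-++ (swapT a b p) ps qs

Apart : List ℕ → ℕ → ℕ → ℕ × ℕ → Set
Apart p x y (c , d) = Position p c × Position p d × x ≢ c × x ≢ d × y ≢ c × y ≢ d

Apart-swapT : ∀ a b {p x y} cd → Apart p x y cd → Apart (swapT a b p) x y cd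
Apart-swapT a b _ (pos-c , pos-d , distinct) =
  position-swapT a b pos-c , position-swapT a b pos-d , distinct

swapT-mulTs : ∀ p ps {x y} → Position p x → Position p y → All (Apart p x y) ps →
  swapT x y (mulTs p ps) ≡ mulTs (swapT x y p) ps
swapT-mulTs p [] _ _ [] = refl
swapT-mulTs p ((c , d) ∷ ps) {x} {y} pos-x pos-y ((pos-c , pos-d , x≢c , x≢d , y≢c , y≢d) ∷ apart) =
  begin
  swapT x y (mulTs (swapT c d p) ps)
    ≡⟨ swapT-mulTs (swapT c d p) ps (position-swapT c d pos-x) (position-swapT c d pos-y)
                   (All.map (Apart-swapT c d _) apart) ⟩
  mulTs (swapT x y (swapT c d p)) ps
    ≡⟨ cong (λ q → mulTs q ps) (swapT-comm p pos-x pos-y pos-c pos-d x≢c x≢d y≢c y≢d) ⟩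
  mulTs (swapT c d (swapT x y p)) ps ∎
  where open ≡-Reasoning

mulTs-last-to-front : ∀ p ps {x y} → Position p x → Position p y → All (Apart p x y) ps →
  mulTs p (ps ++ [ (x , y) ]) ≡ mulTs p ((x , y) ∷ ps)
mulTs-last-to-front p ps pos-x pos-y apart =
  trans (mulTs-++ p ps _) (swapT-mulTs p ps pos-x pos-y apart)

sweep : ℕ → ℕ → ℕ → List (ℕ × ℕ)
sweep a lo j = map (λ b → (a , b)) (seg lo j)

sweep-suc : ∀ a lo j → sweep a lo (suc j) ≡ (a , lo) ∷ sweep a (suc lo) j
sweep-suc a lo j = cong (map (λ b → (a , b))) (seg-suc lo j)

length-sweep : ∀ a lo j → length (sweep a lo j) ≡ j
length-sweep a lo j = trans (length-map _ (seg lo j)) (length-seg lo j)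

All-sweep : ∀ {ℓ} {P : ℕ × ℕ → Set ℓ} a lo j → (∀ {i} → i < j → P (a , lo + i)) →
  All P (sweep a lo j)
All-sweep a lo zero _ = []
All-sweep {P = P} a lo (suc j) P-at = subst (All P) (sym (sweep-suc a lo j))
  (subst (λ b → P (a , b)) (+-identityʳ lo) (P-at (s≤s z≤n)) ∷
   All-sweep a (suc lo) j (λ i<j → subst (λ b → P (a , b)) (+-suc lo _) (P-at (s≤s i<j))))

∉-last : ∀ xs {c x : ℕ} → All (x ≢_) (map proj₂ (xs ++ [ (c , x) ])) → ⊥
∉-last [] (x≢x ∷ []) = x≢x refl
∉-last (_ ∷ xs) (_ ∷ x∉) = ∉-last xs x∉

-- Pieri chains from S_{k+1} ⊆ S_n

record Embedded (m n : ℕ) (p : List ℕ) : Set where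
  field
    m≤n : m ≤ n
    length≡ : length p ≡ n
    bounded : ∀ {c} → c ≤ m → at p c ≤ m
    fixed : ∀ {c} → m < c → c ≤ n → at p c ≡ c

  within : ∀ {c} → 1 ≤ c → c ≤ n → Position p c
  within = position-within length≡

embed-Embedded : ∀ {m n w} → IsPerm m w → m ≤ n → Embedded m n (embed m n w)
embed-Embedded {m} {n} {w} w-perm m≤n = record
  { m≤n = m≤n
  ; length≡ = trans (length-++ w)
                    (trans (cong₂ _+_ length-w (length-seg (suc m) (n ∸ m))) (m+[n∸m]≡n m≤n))
  ; bounded = bounded
  ; fixed = fixed
  }
  where
  length-w : length w ≡ m
  length-w = trans (↭-length w-perm) (length-seg 1 m)
  bounded : ∀ {c} → c ≤ m → at (embed m n w) c ≤ m
  bounded {zero} _ = subst (_≤ m) (sym (at-zero (embed m n w))) z≤n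
  bounded {suc i} c≤m = subst (_≤ m) (sym (at-++ˡ w i<w))
    (≤-pred (∈-seg⇒< 1 m (∈-resp-↭ w-perm (at-∈ w i<w))))
    where
    i<w : i < length w
    i<w = subst (suc i ≤_) (sym length-w) c≤m
  fixed : ∀ {c} → m < c → c ≤ n → at (embed m n w) c ≡ c
  fixed m<c c≤n with i , refl ← m≤n⇒∃[o]m+o≡n m<c = begin
    at (w ++ seg (suc m) (n ∸ m)) (suc (m + i))         ≡⟨ cong (λ l → at (embed m n w) (suc (l + i))) length-w ⟨
    at (w ++ seg (suc m) (n ∸ m)) (suc (length w + i))  ≡⟨ at-++ʳ w _ i ⟩
    at (seg (suc m) (n ∸ m)) (suc i)                    ≡⟨ at-seg (suc m) (n ∸ m) i<n∸m ⟩
    suc m + i                                           ∎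
    where
    open ≡-Reasoning
    i<n∸m : i < n ∸ m
    i<n∸m = subst (_≤ n ∸ m) (m+n∸m≡n m (suc i)) (∸-monoˡ-≤ m (subst (_≤ n) (sym (+-suc m i)) c≤n))

Embedded-swapT : ∀ {m n p a b} → Embedded m n p → 1 ≤ a → a ≤ m → 1 ≤ b → b ≤ m →
  Embedded m n (swapT a b p)
Embedded-swapT {m} {n} {p} {a} {b} emb 1≤a a≤m 1≤b b≤m = record
  { m≤n = m≤n
  ; length≡ = trans (length-swapT a b p) length≡
  ; bounded = bounded′
  ; fixed = λ m<c c≤n → trans
      (at-swapT-other a b p (within (≤-trans (s≤s z≤n) m<c) c≤n)
        (>⇒≢ (≤-<-trans a≤m m<c)) (>⇒≢ (≤-<-trans b≤m m<c)))
      (fixed m<c c≤n)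
  }
  where
  open Embedded emb
  bounded′ : ∀ {c} → c ≤ m → at (swapT a b p) c ≤ m
  bounded′ {zero} _ = subst (_≤ m) (sym (at-zero (swapT a b p))) z≤n
  bounded′ {suc c} c≤m = subst (_≤ m) (sym (at-swapT a b p (within (s≤s z≤n) (≤-trans c≤m m≤n))))
    (bounded (τ-preserves (_≤ m) a≤m b≤m c≤m))

PieriForms : ℕ → ℕ → List ℕ → List ℕ → Set
PieriForms k m w u =
    (Σ ℕ λ a → 1 ≤ a × a ≤ k × u ≡ mulTs w (sweep a (suc (suc k)) m))
  ⊎ (Σ ℕ λ a → 1 ≤ a × a ≤ k × u ≡ mulTs w (sweep a (suc k) m))
  ⊎ (Σ ℕ λ a₁ → Σ ℕ λ a₂ → 1 ≤ a₁ × a₁ ≤ k × 1 ≤ a₂ × a₂ ≤ k × a₁ ≢ a₂ ×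
      u ≡ mulTs w ((a₁ , suc k) ∷ sweep a₂ (suc (suc k)) (m ∸ 1)))

module PieriChain (k n : ℕ) where

  -- The state after t_{a,k+2} t_{a,k+3} ⋯ t_{a,top}, where t_{a,k+2} exchanged v = p(a) ≤ k+1
  -- with the fixed point k+2.
  record Climbing (p : List ℕ) (a top v : ℕ) : Set where
    field
      length≡ : length p ≡ n
      1≤a : 1 ≤ a
      a≤k : a ≤ k
      at-a : at p a ≡ top
      at-k+2 : at p (suc (suc k)) ≡ v
      v≤k+1 : v ≤ suc k
      below-v : ∀ {c} → a < c → c ≤ suc k → at p c < v
      fixed : ∀ {c} → top < c → c ≤ n → at p c ≡ c
      k+2≤top : suc (suc k) ≤ top
      top≤n : top ≤ n

    a<k+1 : a < suc k
    a<k+1 = s≤s a≤k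

    a<k+2 : a < suc (suc k)
    a<k+2 = m<n⇒m<1+n a<k+1

    a<top : a < top
    a<top = <-≤-trans a<k+2 k+2≤top

    k+2≤n : suc (suc k) ≤ n
    k+2≤n = ≤-trans k+2≤top top≤n

    a≤n : a ≤ n
    a≤n = <⇒≤ (<-≤-trans a<top top≤n)

    ≤length : ∀ {c} → c ≤ n → c ≤ length p
    ≤length = subst (_ ≤_) (sym length≡)

    within : ∀ {c} → 1 ≤ c → c ≤ n → Position p c
    within = position-within length≡

    at-swapT-elsewhere : ∀ x y {c} → 1 ≤ c → c ≤ n → c ≢ x → c ≢ y → at (swapT x y p) c ≡ at p c
    at-swapT-elsewhere x y 1≤c c≤n = at-swapT-other x y p (within 1≤c c≤n)

  -- Since the fixed point k+2 lies between, the first b beyond k+1 can only be k+2.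
  enter : ∀ {p a b} → Embedded (suc k) n p → 1 ≤ a → a ≤ k → suc k < b → b ≤ n →
    len (swapT a b p) ≡ suc (len p) →
    b ≡ suc (suc k) × Climbing (swapT a (suc (suc k)) p) a (suc (suc k)) (at p a)
  enter {p} {a} {b} emb 1≤a a≤k k+1<b b≤n len-suc = b≡k+2 , record
    { length≡ = trans (length-swapT a _ p) length≡
    ; 1≤a = 1≤a
    ; a≤k = a≤k
    ; at-a = trans (at-swapT-a _ p (within 1≤a (<⇒≤ (<-≤-trans a<k+2 k+2≤n)))) at-k+2
    ; at-k+2 = at-swapT-b a p (within (s≤s z≤n) k+2≤n)
    ; v≤k+1 = at-a≤k+1
    ; below-v = λ {c} a<c c≤k+1 → subst (_< at p a)
        (sym (elsewhere (m<n⇒0<n a<c) (≤-trans c≤k+1 (<⇒≤ k+2≤n)) (>⇒≢ a<c) (<⇒≢ (s≤s c≤k+1))))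
        (below-a a<c c≤k+1)
    ; fixed = λ k+2<c c≤n → trans
        (elsewhere (m<n⇒0<n k+2<c) c≤n (>⇒≢ (<-trans a<k+2 k+2<c)) (>⇒≢ k+2<c))
        (fixed (<-trans (n<1+n _) k+2<c) c≤n)
    ; k+2≤top = ≤-refl
    ; top≤n = k+2≤n
    }
    where
    open Embedded emb
    k+2≤n : suc (suc k) ≤ n
    k+2≤n = ≤-trans k+1<b b≤n
    a<k+2 : a < suc (suc k)
    a<k+2 = s≤s (m≤n⇒m≤1+n a≤k)
    at-a≤k+1 : at p a ≤ suc k
    at-a≤k+1 = bounded (m≤n⇒m≤1+n a≤k)
    at-k+2 : at p (suc (suc k)) ≡ suc (suc k)
    at-k+2 = fixed ≤-refl k+2≤n
    elsewhere : ∀ {c} → 1 ≤ c → c ≤ n → c ≢ a → c ≢ suc (suc k) →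
      at (swapT a (suc (suc k)) p) c ≡ at p c
    elsewhere 1≤c c≤n = at-swapT-other a _ p (within 1≤c c≤n)
    cover : BruhatCover p a b
    cover = len-swapT-suc⇒cover 1≤a (<-≤-trans a<k+2 k+1<b) (subst (b ≤_) (sym length≡) b≤n) len-suc
    b≡k+2 : b ≡ suc (suc k)
    b≡k+2 with m≤n⇒m<n∨m≡n k+1<b
    ... | inj₂ k+2≡b = sym k+2≡b
    ... | inj₁ k+2<b = ⊥-elim (BruhatCover.no-value-between cover a<k+2 k+2<b
          (subst (at p a ≤_) (sym at-k+2) (m≤n⇒m≤1+n at-a≤k+1))
          (subst₂ _≤_ (sym at-k+2) (sym (fixed k+1<b b≤n)) (<⇒≤ k+2<b)))
    below-a : ∀ {c} → a < c → c ≤ suc k → at p c < at p a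
    below-a {c} a<c c≤k+1 with at p c <? at p a
    ... | yes below = below
    ... | no not-below = ⊥-elim (BruhatCover.no-value-between cover
            a<c (<-≤-trans (s≤s c≤k+1) (≤-reflexive (sym b≡k+2))) (≮⇒≥ not-below)
            (subst (at p c ≤_) (trans (sym at-k+2) (cong (at p) (sym b≡k+2))) (m≤n⇒m≤1+n (bounded c≤k+1))))

  open Climbing

  climb-step : ∀ {p a top v} → Climbing p a top v → suc top ≤ n →
    Climbing (swapT a (suc top) p) a (suc top) v
  climb-step {p} {a} {top} {v} cl top<n = record
    { length≡ = trans (length-swapT a (suc top) p) (length≡ cl)
    ; 1≤a = 1≤a cl
    ; a≤k = a≤k cl
    ; at-a = trans (at-swapT-a (suc top) p (within cl (1≤a cl) (a≤n cl)))
                   (fixed cl ≤-refl top<n)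
    ; at-k+2 = trans (elsewhere (s≤s z≤n) (k+2≤n cl) (>⇒≢ (a<k+2 cl)) (<⇒≢ (s≤s (k+2≤top cl))))
                     (at-k+2 cl)
    ; v≤k+1 = v≤k+1 cl
    ; below-v = λ a<c c≤k+1 → subst (_< v)
        (sym (elsewhere (m<n⇒0<n a<c) (≤-trans c≤k+1 (<⇒≤ (k+2≤n cl)))
               (>⇒≢ a<c) (<⇒≢ (s≤s (≤-trans c≤k+1 (<⇒≤ (k+2≤top cl)))))))
        (below-v cl a<c c≤k+1)
    ; fixed = λ top+1<c c≤n → trans
        (elsewhere (m<n⇒0<n top+1<c) c≤n (>⇒≢ (<-trans (a<top cl) (<-trans (n<1+n top) top+1<c)))
                   (>⇒≢ top+1<c))
        (fixed cl (<-trans (n<1+n top) top+1<c) c≤n)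
    ; k+2≤top = m≤n⇒m≤1+n (k+2≤top cl)
    ; top≤n = top<n
    }
    where
    elsewhere : ∀ {c} → 1 ≤ c → c ≤ n → c ≢ a → c ≢ suc top → at (swapT a (suc top) p) c ≡ at p c
    elsewhere = at-swapT-elsewhere cl a (suc top)

  climb-swap-k+1 : ∀ {p a top v a′} → Climbing p a top v → a < a′ → a′ ≤ k →
    Climbing (swapT a′ (suc k) p) a top v
  climb-swap-k+1 {p} {a} {top} {v} {a′} cl a<a′ a′≤k = record
    { length≡ = trans (length-swapT a′ (suc k) p) (length≡ cl)
    ; 1≤a = 1≤a cl
    ; a≤k = a≤k cl
    ; at-a = trans (elsewhere (1≤a cl) (a≤n cl) (<⇒≢ a<a′) (<⇒≢ (a<k+1 cl)))
                   (at-a cl)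
    ; at-k+2 = trans (elsewhere (s≤s z≤n) (k+2≤n cl) (>⇒≢ a′<k+2) (>⇒≢ (n<1+n _))) (at-k+2 cl)
    ; v≤k+1 = v≤k+1 cl
    ; below-v = below-v′
    ; fixed = λ top<c c≤n → trans
        (elsewhere (m<n⇒0<n top<c) c≤n (>⇒≢ (<-trans a′<top top<c)) (>⇒≢ (<-trans (k+2≤top cl) top<c)))
        (fixed cl top<c c≤n)
    ; k+2≤top = k+2≤top cl
    ; top≤n = top≤n cl
    }
    where
    elsewhere : ∀ {c} → 1 ≤ c → c ≤ n → c ≢ a′ → c ≢ suc k → at (swapT a′ (suc k) p) c ≡ at p c
    elsewhere = at-swapT-elsewhere cl a′ (suc k)
    a′<k+2 : a′ < suc (suc k)
    a′<k+2 = s≤s (m≤n⇒m≤1+n a′≤k)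
    a′<top : a′ < top
    a′<top = <-≤-trans a′<k+2 (k+2≤top cl)
    k+1≤n : suc k ≤ n
    k+1≤n = <⇒≤ (k+2≤n cl)
    below-v′ : ∀ {c} → a < c → c ≤ suc k → at (swapT a′ (suc k) p) c < v
    below-v′ {c} a<c c≤k+1 with c ≟ a′ | c ≟ suc k
    ... | yes refl | _ =
      subst (_< v)
        (sym (at-swapT-a (suc k) p (within cl (m<n⇒0<n a<c) (<⇒≤ (<-≤-trans a′<k+2 (k+2≤n cl))))))
        (below-v cl (a<k+1 cl) ≤-refl)
    ... | no _ | yes refl =
      subst (_< v) (sym (at-swapT-b a′ p (within cl (s≤s z≤n) k+1≤n))) (below-v cl a<a′ (m≤n⇒m≤1+n a′≤k))
    ... | no c≢a′ | no c≢k+1 =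
      subst (_< v) (sym (elsewhere (m<n⇒0<n a<c) (≤-trans c≤k+1 k+1≤n) c≢a′ c≢k+1)) (below-v cl a<c c≤k+1)

  climb-k+1-blocked : ∀ {p a top v} → Climbing p a top v → len (swapT a (suc k) p) ≢ suc (len p)
  climb-k+1-blocked {p} {a} {top} {v} cl len-suc = <-irrefl refl (begin-strict
    top           ≡⟨ at-a cl ⟨
    at p a        <⟨ BruhatCover.ascent cover ⟩
    at p (suc k)  <⟨ below-v cl (a<k+1 cl) ≤-refl ⟩
    v             ≤⟨ v≤k+1 cl ⟩
    suc k         <⟨ k+2≤top cl ⟩
    top           ∎)
    where
    open ≤-Reasoning
    cover : BruhatCover p a (suc k)
    cover = len-swapT-suc⇒cover (1≤a cl) (a<k+1 cl) (≤length cl (<⇒≤ (k+2≤n cl))) len-suc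

  -- position k+2, holding v, would lie between
  climb-larger-a-blocked : ∀ {p a top v a′ b} → Climbing p a top v → a < a′ → a′ ≤ k → top < b → b ≤ n →
    len (swapT a′ b p) ≢ suc (len p)
  climb-larger-a-blocked {p} {a} {top} {v} {a′} {b} cl a<a′ a′≤k top<b b≤n len-suc =
    BruhatCover.no-value-between cover a′<k+2 k+2<b
      (<⇒≤ (subst (at p a′ <_) (sym (at-k+2 cl)) (below-v cl a<a′ (m≤n⇒m≤1+n a′≤k))))
      (subst₂ _≤_ (sym (at-k+2 cl)) (sym (fixed cl top<b b≤n))
        (≤-trans (v≤k+1 cl) (<⇒≤ (<-trans (n<1+n _) k+2<b))))
    where
    a′<k+2 : a′ < suc (suc k)
    a′<k+2 = s≤s (m≤n⇒m≤1+n a′≤k)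
    k+2<b : suc (suc k) < b
    k+2<b = ≤-<-trans (k+2≤top cl) top<b
    cover : BruhatCover p a′ b
    cover = len-swapT-suc⇒cover (m<n⇒0<n a<a′) (<-trans a′<k+2 k+2<b) (≤length cl b≤n) len-suc

  -- the fixed point top+1 would lie between
  climb-skip-blocked : ∀ {p a top v b} → Climbing p a top v → suc top < b → b ≤ n →
    len (swapT a b p) ≢ suc (len p)
  climb-skip-blocked {p} {a} {top} {v} {b} cl top+1<b b≤n len-suc =
    BruhatCover.no-value-between cover (m<n⇒m<1+n (a<top cl)) top+1<b
      (subst₂ _≤_ (sym (at-a cl)) (sym at-top+1) (n≤1+n top))
      (subst₂ _≤_ (sym at-top+1) (sym (fixed cl (<-trans (n<1+n top) top+1<b) b≤n)) (<⇒≤ top+1<b))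
    where
    at-top+1 : at p (suc top) ≡ suc top
    at-top+1 = fixed cl ≤-refl (≤-trans (<⇒≤ top+1<b) b≤n)
    cover : BruhatCover p a b
    cover = len-swapT-suc⇒cover (1≤a cl) (<-trans (a<top cl) (<-trans (n<1+n top) top+1<b))
              (≤length cl b≤n) len-suc

  climb-forced : ∀ {p a top v a′ b} → Climbing p a top v → a ≤ a′ → a′ ≤ k → top < b → b ≤ n →
    len (swapT a′ b p) ≡ suc (len p) → a′ ≡ a × b ≡ suc top
  climb-forced cl a≤a′ a′≤k top<b b≤n len-suc with m≤n⇒m<n∨m≡n a≤a′ | m≤n⇒m<n∨m≡n top<b
  ... | inj₁ a<a′ | _ = ⊥-elim (climb-larger-a-blocked cl a<a′ a′≤k top<b b≤n len-suc)
  ... | inj₂ refl | inj₁ top+1<b = ⊥-elim (climb-skip-blocked cl top+1<b b≤n len-suc)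
  ... | inj₂ refl | inj₂ refl = refl , refl

  data TailShape (a top : ℕ) : List (ℕ × ℕ) → Set where
    sweeping : ∀ j → TailShape a top (sweep a (suc top) j)
    sweeping-then-k+1 : ∀ j {a′} → a < a′ → a′ ≤ k → top + j ≤ n →
      TailShape a top (sweep a (suc top) j ++ [ (a′ , suc k) ])

  TailShape-cons : ∀ {a top rest} → TailShape a (suc top) rest → TailShape a top ((a , suc top) ∷ rest)
  TailShape-cons {a} {top} (sweeping j) =
    subst (TailShape a top) (sweep-suc a (suc top) j) (sweeping (suc j))
  TailShape-cons {a} {top} (sweeping-then-k+1 j {a′} a<a′ a′≤k top+j≤n) =
    subst (TailShape a top) (cong (_++ [ (a′ , suc k) ]) (sweep-suc a (suc top) j))
      (sweeping-then-k+1 (suc j) a<a′ a′≤k (subst (_≤ n) (sym (+-suc top j)) top+j≤n))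

  -- k+2, …, top have already been used as values of b
  Beyond : ℕ → ℕ → Set
  Beyond top b = suc k < b → top < b

  Beyond-next : ∀ {top b} → Beyond top b → suc top ≢ b → Beyond (suc top) b
  Beyond-next beyond top+1≢b k+1<b = ≤∧≢⇒< (beyond k+1<b) top+1≢b

  nothing-after-k+1 : ∀ {p a top v a′} rest → Climbing p a top v → a < a′ → PieriSteps k p rest →
    Linked _≤_ (a′ ∷ map proj₁ rest) → All (suc k ≢_) (map proj₂ rest) →
    All (Beyond top) (map proj₂ rest) → rest ≡ []
  nothing-after-k+1 [] _ _ _ _ _ _ = refl
  nothing-after-k+1 {a = a} ((a″ , b) ∷ _) cl a<a′ (_ , a″≤k , k<b , b≤ , len-suc , _)
    (a′≤a″ ∷ _) (k+1≢b ∷ _) (beyond ∷ _) =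
    ⊥-elim (<⇒≢ a<a″ (sym (proj₁ (climb-forced cl (<⇒≤ a<a″) a″≤k (beyond (≤∧≢⇒< k<b k+1≢b))
                                    (subst (_ ≤_) (length≡ cl) b≤) len-suc))))
    where
    a<a″ : a < a″
    a<a″ = <-≤-trans a<a′ a′≤a″

  chain-tail : ∀ {p a top v} rest → Climbing p a top v → PieriSteps k p rest →
    Linked _≤_ (a ∷ map proj₁ rest) → Unique (map proj₂ rest) →
    All (Beyond top) (map proj₂ rest) → TailShape a top rest
  chain-tail [] _ _ _ _ _ = sweeping 0
  chain-tail ((a′ , b) ∷ rest) cl (_ , a′≤k , k<b , b≤ , len-suc , steps)
    (a≤a′ ∷ linked) (b∉ ∷ unique) (beyond ∷ beyonds) with m≤n⇒m<n∨m≡n k<b | m≤n⇒m<n∨m≡n a≤a′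
  ... | inj₁ k+1<b | _ with climb-forced cl a≤a′ a′≤k (beyond k+1<b) (subst (_ ≤_) (length≡ cl) b≤) len-suc
  ...   | refl , refl = TailShape-cons (chain-tail rest (climb-step cl (subst (_ ≤_) (length≡ cl) b≤))
          steps linked unique (All.zipWith (uncurry Beyond-next) (beyonds , b∉)))
  chain-tail ((a′ , b) ∷ rest) cl (_ , _ , _ , _ , len-suc , _) _ _ _
      | inj₂ refl | inj₂ refl = ⊥-elim (climb-k+1-blocked cl len-suc)
  chain-tail ((a′ , b) ∷ rest) cl (_ , a′≤k , _ , _ , _ , steps) (_ ∷ linked) (b∉ ∷ _) (_ ∷ beyonds)
      | inj₂ refl | inj₁ a<a′
    with refl ← nothing-after-k+1 rest (climb-swap-k+1 cl a<a′ a′≤k) a<a′ steps linked b∉ beyonds =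
      sweeping-then-k+1 0 a<a′ a′≤k (subst (_≤ n) (sym (+-identityʳ _)) (top≤n cl))

  form₁ : ∀ {p ps a j} → 1 ≤ a → a ≤ k → ps ≡ sweep a (suc (suc k)) j →
    PieriForms k (length ps) p (mulTs p ps)
  form₁ {p} {a = a} {j} 1≤a a≤k refl =
    inj₁ (a , 1≤a , a≤k , cong (λ i → mulTs p (sweep a (suc (suc k)) i)) (sym (length-sweep a _ j)))

  form₂ : ∀ {p ps a j} → 1 ≤ a → a ≤ k → ps ≡ sweep a (suc k) j →
    PieriForms k (length ps) p (mulTs p ps)
  form₂ {p} {a = a} {j} 1≤a a≤k refl =
    inj₂ (inj₁ (a , 1≤a , a≤k , cong (λ i → mulTs p (sweep a (suc k) i)) (sym (length-sweep a _ j))))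

  form₃ : ∀ {p} ps {a₁ a₂ j} → 1 ≤ a₁ → a₁ ≤ k → 1 ≤ a₂ → a₂ ≤ k → a₁ ≢ a₂ → length ps ≡ suc j →
    mulTs p ps ≡ mulTs p ((a₁ , suc k) ∷ sweep a₂ (suc (suc k)) j) →
    PieriForms k (length ps) p (mulTs p ps)
  form₃ {p} ps {a₁} {a₂} 1≤a₁ a₁≤k 1≤a₂ a₂≤k a₁≢a₂ length≡ u≡ =
    inj₂ (inj₂ (a₁ , a₂ , 1≤a₁ , a₁≤k , 1≤a₂ , a₂≤k , a₁≢a₂ ,
      trans u≡ (cong (λ i → mulTs p ((a₁ , suc k) ∷ sweep a₂ (suc (suc k)) (i ∸ 1))) (sym length≡))))

  k+1-to-front : ∀ {p a a′ j} → Embedded (suc k) n p → 1 ≤ a → a < a′ → a′ ≤ k → suc (suc k) + j ≤ n →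
    mulTs p (sweep a (suc (suc k)) (suc j) ++ [ (a′ , suc k) ]) ≡
    mulTs p ((a′ , suc k) ∷ sweep a (suc (suc k)) (suc j))
  k+1-to-front {p} {a} {a′} {j} emb 1≤a a<a′ a′≤k k+2+j≤n =
    mulTs-last-to-front p _ (position-p (m<n⇒0<n a<a′) (≤-trans a′≤k k≤n)) (position-p (s≤s z≤n) k+1≤n)
      (All-sweep a _ (suc j) λ {i} i≤j →
        position-p 1≤a (≤-trans (<⇒≤ (<-trans a<a′ (s≤s a′≤k))) k+1≤n) ,
        position-p (s≤s z≤n) (≤-trans (+-monoʳ-≤ (suc (suc k)) (≤-pred i≤j)) k+2+j≤n) ,
        >⇒≢ a<a′ , <⇒≢ (s≤s (≤-trans a′≤k (≤-trans (n≤1+n k) (s≤s (m≤m+n k i))))) ,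
        >⇒≢ (<-trans a<a′ (s≤s a′≤k)) , <⇒≢ (s≤s (s≤s (m≤m+n k i))))
    where
    open Embedded emb using () renaming (within to position-p; m≤n to k+1≤n)
    k≤n : k ≤ n
    k≤n = ≤-trans (n≤1+n k) k+1≤n

  starting-beyond-k+1 : ∀ {p a b} rest → Embedded (suc k) n p → 1 ≤ a → a ≤ k → suc k < b → b ≤ n →
    len (swapT a b p) ≡ suc (len p) → PieriSteps k (swapT a b p) rest →
    Linked _≤_ (a ∷ map proj₁ rest) → All (b ≢_) (map proj₂ rest) → Unique (map proj₂ rest) →
    PieriForms k (length ((a , b) ∷ rest)) p (mulTs p ((a , b) ∷ rest))
  starting-beyond-k+1 {p} {a} rest emb 1≤a a≤k k+1<b b≤n len-suc steps linked b∉ unique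
    with enter emb 1≤a a≤k k+1<b b≤n len-suc
  ... | refl , cl with chain-tail rest cl steps linked unique (All.map (Beyond-next id) b∉)
  ...   | sweeping j = form₁ {p} 1≤a a≤k (sym (sweep-suc a (suc (suc k)) j))
  ...   | sweeping-then-k+1 j {a′} a<a′ a′≤k k+2+j≤n =
          form₃ {p} ps {j = suc j} (m<n⇒0<n a<a′) a′≤k 1≤a a≤k (>⇒≢ a<a′) length-ps
            (trans (cong (λ ts → mulTs p (ts ++ [ (a′ , suc k) ])) (sym (sweep-suc a (suc (suc k)) j)))
                   (k+1-to-front emb 1≤a a<a′ a′≤k k+2+j≤n))
    where
    ps : List (ℕ × ℕ)
    ps = (a , suc (suc k)) ∷ sweep a (suc (suc (suc k))) j ++ [ (a′ , suc k) ]
    length-ps : length ps ≡ suc (suc j)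
    length-ps = cong suc (trans (length-++ (sweep a _ j))
                                (trans (cong (_+ 1) (length-sweep a _ j)) (+-comm j 1)))

  starting-at-k+1 : ∀ {p a} rest → Embedded (suc k) n p → 1 ≤ a → a ≤ k →
    PieriSteps k (swapT a (suc k) p) rest → Linked _≤_ (a ∷ map proj₁ rest) →
    All (suc k ≢_) (map proj₂ rest) → Unique (map proj₂ rest) →
    PieriForms k (length ((a , suc k) ∷ rest)) p (mulTs p ((a , suc k) ∷ rest))
  starting-at-k+1 {p} {a} [] _ 1≤a a≤k _ _ _ _ = form₂ {p} 1≤a a≤k (sym (sweep-suc a (suc k) 0))
  starting-at-k+1 {p} {a} ((a′ , b) ∷ rest) emb 1≤a a≤k (1≤a′ , a′≤k , k<b , b≤ , len-suc , steps)
    (a≤a′ ∷ linked) (k+1≢b ∷ k+1∉) (b∉ ∷ unique)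
    with enter emb′ 1≤a′ a′≤k (≤∧≢⇒< k<b k+1≢b) (subst (_ ≤_) (Embedded.length≡ emb′) b≤) len-suc
    where
    emb′ : Embedded (suc k) n (swapT a (suc k) p)
    emb′ = Embedded-swapT emb 1≤a (m≤n⇒m≤1+n a≤k) (s≤s z≤n) ≤-refl
  ... | refl , cl with chain-tail rest cl steps linked unique (All.map (Beyond-next id) b∉)
  ...   | sweeping-then-k+1 j _ _ _ = ⊥-elim (∉-last (sweep a′ _ j) k+1∉)
  ...   | sweeping j with m≤n⇒m<n∨m≡n a≤a′
  ...     | inj₂ refl = form₂ {p} 1≤a a≤k
            (sym (trans (sweep-suc a (suc k) (suc j))
                        (cong ((a , suc k) ∷_) (sweep-suc a (suc (suc k)) j))))
  ...     | inj₁ a<a′ =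
            form₃ {p} ((a , suc k) ∷ (a′ , suc (suc k)) ∷ sweep a′ (suc (suc (suc k))) j) {j = suc j}
              1≤a a≤k 1≤a′ a′≤k (<⇒≢ a<a′) (cong (suc ∘ suc) (length-sweep a′ (suc (suc (suc k))) j))
              (cong (λ ts → mulTs p ((a , suc k) ∷ ts)) (sym (sweep-suc a′ (suc (suc k)) j)))

  pieri-forms : ∀ {p} ps → Embedded (suc k) n p → 1 ≤ length ps → PieriSteps k p ps →
    Linked _≤_ (map proj₁ ps) → Unique (map proj₂ ps) → PieriForms k (length ps) p (mulTs p ps)
  pieri-forms ((a , b) ∷ rest) emb _ (1≤a , a≤k , k<b , b≤ , len-suc , steps) linked (b∉ ∷ unique)
    with m≤n⇒m<n∨m≡n k<b
  ... | inj₁ k+1<b = starting-beyond-k+1 rest emb 1≤a a≤k k+1<b (subst (_ ≤_) (Embedded.length≡ emb) b≤)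
                       len-suc steps linked b∉ unique
  ... | inj₂ refl = starting-at-k+1 rest emb 1≤a a≤k steps linked b∉ unique

lemma3p5 : (k m n₂ n : ℕ) → 1 ≤ k → 1 ≤ m → k + 1 ≡ n₂ → n₂ < n →
    (w u : List ℕ) → IsPerm n₂ w → IsPerm n u →
    PieriTerm k m (embed n₂ n w) u →
    (Σ ℕ λ a → 1 ≤ a × a ≤ k ×
        u ≡ mulTs (embed n₂ n w) (map (λ j → (a , j)) (seg (k + 2) m)))
    ⊎ ((Σ ℕ λ a → 1 ≤ a × a ≤ k ×
        u ≡ mulTs (embed n₂ n w) (map (λ j → (a , j)) (seg (k + 1) m)))
    ⊎ (Σ ℕ λ a₁ → Σ ℕ λ a₂ → 1 ≤ a₁ × a₁ ≤ k × 1 ≤ a₂ × a₂ ≤ k × a₁ ≢ a₂ ×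
        u ≡ mulTs (embed n₂ n w)
              ((a₁ , k + 1) ∷ map (λ j → (a₂ , j)) (seg (k + 2) (m ∸ 1)))))
-- k + 1 and k + 2 do not reduce; the with-abstraction turns them into suc k and suc (suc k)
lemma3p5 k m n₂ n _ 1≤m refl n₂<n w u w-perm _ (ps , refl , linked , unique , steps , refl)
  with k + 1 | +-comm k 1 | k + 2 | +-comm k 2
... | .(suc k) | refl | .(suc (suc k)) | refl =
  PieriChain.pieri-forms k n ps (embed-Embedded w-perm (<⇒≤ n₂<n)) 1≤m steps linked unique
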